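{- Let $\Phi=(A;\{E_i\}_{i=0}^d;A^*;\{E^*_i\}_{i=0}^d)$ be a pre Leonard system on $V$ with $d\ge2$, eigenvalue sequence $\{\theta_i\}_{i=0}^d$ and dual eigenvalue sequence $\{\theta^*_i\}_{i=0}^d$. Suppose there exist scalars $\varphi_1,\dots,\varphi_d\in\mathbb F$ and a basis of $V$ with respect to which $A$ is represented by the lower bidiagonal matrix with diagonal entries $\theta_0,\dots,\theta_d$ and all subdiagonal entries $1$, and $A^*$ by the upper bidiagonal matrix with diagonal entries $\theta^*_0,\dots,\theta^*_d$ and superdiagonal entries $\varphi_1,\dots,\varphi_d$. Define $\vartheta_i=\varphi_i-(\theta^*_i-\theta^*_0)(\theta_{i-1}-\theta_d)$ for $1\le i\le d$. Then $$\sum_{i=0}^{d-2}E_dA^*E_iE^*_0(\theta_i-\theta_{d-1})=E_dE^*_0(\vartheta_1-\vartheta_d).$$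
   Context: Let $\mathbb F$ be a field, $d\ge0$ an integer, $V$ an $\mathbb F$-vector space of dimension $d+1$. A matrix $M$ represents $X\in{\rm End}(V)$ with respect to a basis $\{v_i\}$ if $Xv_j=\sum_i M_{ij}v_i$. An element $A\in{\rm End}(V)$ is multiplicity-free if it has $d+1$ mutually distinct eigenvalues in $\mathbb F$; its primitive idempotent for an eigenvalue $\theta$ is the projection onto the $\theta$-eigenspace along the sum of the other eigenspaces. A pre Leonard system on $V$ is a sequence $(A;\{E_i\}_{i=0}^d;A^*;\{E^*_i\}_{i=0}^d)$ of elements of ${\rm End}(V)$ ($A^*$ is a second arbitrary element, not an adjoint) such that $A,A^*$ are multiplicity-free, $E_0,\dots,E_d$ is an ordering of the primitive idempotents of $A$ and $E^*_0,\dots,E^*_d$ is an ordering of the primitive idempotents of $A^*$. Its eigenvalue sequence is $\{\theta_i\}$ with $AE_i=\theta_iE_i$, and its dual eigenvalue sequence is $\{\theta^*_i\}$ with $A^*E^*_i=\theta^*_iE^*_i$. -}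

module Defs where

open import Level using (_⊔_)
open import Algebra.Bundles using (CommutativeRing)
open import Data.Nat as ℕ using (ℕ; zero; suc)
open import Data.Fin using (Fin; zero; suc; toℕ; inject₁; fromℕ)
open import Data.Product using (Σ; ∃; _×_; _,_)
open import Relation.Nullary using (¬_; yes; no)
open import Relation.Binary.PropositionalEquality using (_≡_)

record Field (c ℓ : Level.Level) : Set (Level.suc (c ⊔ ℓ)) where
  field
    commutativeRing : CommutativeRing c ℓ
  open CommutativeRing commutativeRing public
  field
    0≉1     : ¬ (0# ≈ 1#)
    inverse : ∀ x → ¬ (x ≈ 0#) → Σ Carrier λ y → (x * y) ≈ 1#

module FieldDefs {c ℓ} (F : Field c ℓ) where
  open Field F public using (Carrier; _≈_; _+_; _*_; -_; 0#; 1#)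

  _-F_ : Carrier → Carrier → Carrier
  x -F y = x + (- y)

  ΣF : ∀ {n} → (Fin n → Carrier) → Carrier
  ΣF {zero}  f = 0#
  ΣF {suc n} f = f zero + ΣF (λ i → f (suc i))

  -- V = F^N (column vectors); End(V) = N×N matrices acting on columns.
  Vec : ℕ → Set c
  Vec N = Fin N → Carrier

  Mat : ℕ → Set c
  Mat N = Fin N → Fin N → Carrier

  _≈V_ : ∀ {N} → Vec N → Vec N → Set ℓ
  u ≈V v = ∀ i → u i ≈ v i

  _≈M_ : ∀ {N} → Mat N → Mat N → Set ℓ
  X ≈M Y = ∀ i j → X i j ≈ Y i j

  _·_ : ∀ {N} → Mat N → Vec N → Vec N
  (X · v) i = ΣF (λ k → X i k * v k)

  _⊙_ : ∀ {N} → Mat N → Mat N → Mat N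
  (X ⊙ Y) i j = ΣF (λ k → X i k * Y k j)

  _⊕_ : ∀ {N} → Mat N → Mat N → Mat N
  (X ⊕ Y) i j = X i j + Y i j

  _⋆_ : ∀ {N} → Carrier → Mat N → Mat N
  (a ⋆ X) i j = a * X i j

  _•_ : ∀ {N} → Carrier → Vec N → Vec N
  (a • v) i = a * v i

  𝟎V : ∀ {N} → Vec N
  𝟎V i = 0#

  𝟎M : ∀ {N} → Mat N
  𝟎M i j = 0#

  I : ∀ {N} → Mat N
  I i j with toℕ i ℕ.≟ toℕ j
  ... | yes _ = 1#
  ... | no  _ = 0#

  ΣM : ∀ {N n} → (Fin n → Mat N) → Mat N
  ΣM {n = zero}  f = 𝟎M
  ΣM {n = suc n} f = f zero ⊕ ΣM (λ i → f (suc i))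

  NonZeroV : ∀ {N} → Vec N → Set ℓ
  NonZeroV v = ∃ λ i → ¬ (v i ≈ 0#)

  IsEigenvalue : ∀ {N} → Mat N → Carrier → Set (c ⊔ ℓ)
  IsEigenvalue X θ = ∃ λ v → NonZeroV v × ((X · v) ≈V (θ • v))

  MultiplicityFree : ∀ {N} → Mat N → Set (c ⊔ ℓ)
  MultiplicityFree {N} X =
    Σ (Fin N → Carrier) λ θ →
      (∀ i j → θ i ≈ θ j → i ≡ j) × (∀ i → IsEigenvalue X (θ i))

  -- E is the primitive idempotent of X for the eigenvalue θ: the projection
  -- onto the θ-eigenspace along the sum of the other eigenspaces, i.e. E is
  -- the identity on the θ-eigenspace and vanishes on every other eigenspace
  -- (for multiplicity-free X these eigenspaces span V, so E is determined).
  IsPrimitiveIdempotent : ∀ {N} → Mat N → Carrier → Mat N → Set (c ⊔ ℓ)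
  IsPrimitiveIdempotent X θ E =
    IsEigenvalue X θ
    × (∀ v → (X · v) ≈V (θ • v) → (E · v) ≈V v)
    × (∀ θ' v → ¬ (θ' ≈ θ) → IsEigenvalue X θ' → (X · v) ≈V (θ' • v) → (E · v) ≈V 𝟎V)

  record PreLeonardSystem (d : ℕ) (A : Mat (suc d)) (E : Fin (suc d) → Mat (suc d))
                          (A* : Mat (suc d)) (E* : Fin (suc d) → Mat (suc d))
                          (θ θ* : Fin (suc d) → Carrier) : Set (c ⊔ ℓ) where
    field
      A-mf   : MultiplicityFree A
      A*-mf  : MultiplicityFree A*
      E-prim  : ∀ i → IsPrimitiveIdempotent A (θ i) (E i)
      E*-prim : ∀ i → IsPrimitiveIdempotent A* (θ* i) (E* i)
      E-distinct  : ∀ i j → θ i ≈ θ j → i ≡ j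
      E*-distinct : ∀ i j → θ* i ≈ θ* j → i ≡ j
      E-all  : ∀ λ' → IsEigenvalue A λ' → ∃ λ i → λ' ≈ θ i
      E*-all : ∀ λ' → IsEigenvalue A* λ' → ∃ λ i → λ' ≈ θ* i

  Invertible : ∀ {N} → Mat N → Set (c ⊔ ℓ)
  Invertible P = ∃ λ Q → ((P ⊙ Q) ≈M I) × ((Q ⊙ P) ≈M I)

  -- X is represented by M w.r.t. the basis given by the columns v_j of P:
  -- X v_j = Σ_i M_ij v_i, i.e. X P = P M.
  Represents : ∀ {N} → Mat N → Mat N → Mat N → Set ℓ
  Represents P M X = (X ⊙ P) ≈M (P ⊙ M)

  lowerBidiag : ∀ {d} → (Fin (suc d) → Carrier) → Mat (suc d)
  lowerBidiag t i j with toℕ i ℕ.≟ toℕ j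
  ... | yes _ = t i
  ... | no  _ with toℕ i ℕ.≟ suc (toℕ j)
  ...   | yes _ = 1#
  ...   | no  _ = 0#

  -- Upper bidiagonal: diagonal t_0..t_d, superdiagonal φ_1..φ_d, where
  -- φ k (k : Fin d) stands for φ_{k+1}; entry (i, i+1) is φ_{i+1}.
  upperBidiag : ∀ {d} → (Fin (suc d) → Carrier) → (Fin d → Carrier) → Mat (suc d)
  upperBidiag t φ i j with toℕ i ℕ.≟ toℕ j
  upperBidiag t φ i j | yes _ = t i
  upperBidiag t φ i zero | no _ = 0#
  upperBidiag t φ i (suc k) | no _ with toℕ i ℕ.≟ toℕ k
  ... | yes _ = φ k
  ... | no  _ = 0#

  -- ϑ_{k+1} = φ_{k+1} - (θ*_{k+1} - θ*_0)(θ_k - θ_d), for k : Fin d.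
  vartheta : ∀ {d} → (θ θ* : Fin (suc d) → Carrier) → (Fin d → Carrier) → Fin d → Carrier
  vartheta {d} θ θ* φ k = φ k -F ((θ* (suc k) -F θ* zero) * (θ (inject₁ k) -F θ (fromℕ d)))

-- With respect to the basis p₀, …, p_d formed by the columns of P, A is lower and A* upper
-- bidiagonal, with distinct diagonal entries. An operator that is triangular in this sense is
-- diagonalisable: every vector is a sum of eigenvectors, built up basis vector by basis vector,
-- and the primitive idempotents are the projections onto the summands. In particular the images
-- of E_d and E*_0 are spanned by p_d and p₀, so each column of either side is the corresponding
-- map applied to a multiple of p₀, and it suffices to evaluate on p₀. There
-- Σ_j (θ_j − θ_{d−1}) E_d A* E_j p₀ = E_d A* (A − θ_{d−1}) p₀ is read off from the bidiagonal
-- forms; the term j = d−1 vanishes, and the term j = d is computed using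
-- (θ_d − θ_{d−1}) E_d p_{d−1} = E_d (A − θ_{d−1}) p_{d−1} = p_d.
module Submission where

open import Level using (_⊔_; 0ℓ)
open import Algebra.Bundles using (CommutativeRing; RawRing)
open import Algebra.Solver.Ring.AlmostCommutativeRing using (fromCommutativeRing; _-Raw-AlmostCommutative⟶_)
import Algebra.Solver.Ring
import Algebra.Solver.Ring.NaturalCoefficients.Default as NaturalCoefficients
open import Data.Empty using (⊥-elim)
open import Data.Fin using (Fin; zero; suc; fromℕ; inject₁; toℕ; punchIn; punchOut; _≟_; lower₁)
open import Data.Fin.Properties
  using (punchInᵢ≢i; punchIn-punchOut; punchIn-injective; toℕ-injective; toℕ-inject₁; toℕ-fromℕ; toℕ<n; inject₁-lower₁)
open import Data.Maybe using (just; nothing)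
open import Data.Nat as ℕ using (ℕ; zero; suc; _∸_)
import Data.Nat.Properties as ℕP
open import Data.Product using (∃; _×_; Σ; _,_; proj₁; proj₂)
open import Data.Vec.Functional using (removeAt; updateAt)
open import Data.Vec.Functional.Properties using (updateAt-updates; updateAt-minimal)
open import Function using (_∘_)
open import Relation.Binary.Definitions using (WeaklyDecidable)
open import Relation.Binary.PropositionalEquality as ≡ using (_≡_; _≢_)
import Relation.Binary.Reasoning.Setoid as SetoidReasoning
open import Relation.Nullary using (¬_; yes; no)
open import Defs

module CommutativeRingSolver {c ℓ} (R : CommutativeRing c ℓ) where
  open CommutativeRing R
  open import Algebra.Properties.Semiring.Mult semiring using (×-homo-+; ×1-homo-*) renaming (_×_ to _×′_)
  open import Algebra.Properties.Ring ring using (-‿distribˡ-*; -‿distribʳ-*; -0#≈0#)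
  open import Algebra.Properties.AbelianGroup +-abelianGroup using (⁻¹-∙-comm)
  open import Algebra.Properties.Group +-group using (⁻¹-involutive)
  open NaturalCoefficients commutativeSemiring using (solve; _:=_; _:+_; _:*_)
  open SetoidReasoning setoid

  -- The coefficient (a , b) stands for the integer a − b; unlike the
  -- coefficients of the carrier itself, equality of these is decidable,
  -- which is what lets the solver cancel x − x.
  ℤ-differences : RawRing 0ℓ 0ℓ
  ℤ-differences = record
    { Carrier = ℕ × ℕ
    ; _≈_     = _≡_
    ; _+_     = λ { (a , b) (c , d) → (a ℕ.+ c , b ℕ.+ d) }
    ; _*_     = λ { (a , b) (c , d) → (a ℕ.* c ℕ.+ b ℕ.* d , a ℕ.* d ℕ.+ b ℕ.* c) }
    ; -_      = λ { (a , b) → (b , a) }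
    ; 0#      = (0 , 0)
    ; 1#      = (1 , 0)
    }

  ⟦_⟧ : ℕ × ℕ → Carrier
  ⟦ a , b ⟧ = a ×′ 1# - b ×′ 1#

  difference-cong : ∀ {x y z w} → x + w ≈ z + y → x - y ≈ z - w
  difference-cong {x} {y} {z} {w} x+w≈z+y = begin
    x - y                       ≈⟨ +-identityʳ (x - y) ⟨
    (x - y) + 0#                ≈⟨ +-congˡ (-‿inverseʳ w) ⟨
    (x - y) + (w - w)           ≈⟨ solve 4 (λ x y w w′ → ((x :+ y) :+ (w :+ w′)) := ((x :+ w) :+ (y :+ w′))) refl x (- y) w (- w) ⟩
    (x + w) + (- y + - w)       ≈⟨ +-cong x+w≈z+y refl ⟩
    (z + y) + (- y + - w)       ≈⟨ solve 4 (λ z y y′ w′ → ((z :+ y) :+ (y′ :+ w′)) := ((z :+ w′) :+ (y :+ y′))) refl z y (- y) (- w) ⟩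
    (z - w) + (y - y)           ≈⟨ +-congˡ (-‿inverseʳ y) ⟩
    (z - w) + 0#                ≈⟨ +-identityʳ (z - w) ⟩
    z - w                       ∎

  +-homo : ∀ p q → ⟦ RawRing._+_ ℤ-differences p q ⟧ ≈ ⟦ p ⟧ + ⟦ q ⟧
  +-homo (a , b) (c , d) = begin
    (a ℕ.+ c) ×′ 1# - (b ℕ.+ d) ×′ 1#   ≈⟨ +-cong (×-homo-+ 1# a c) (trans (-‿cong (×-homo-+ 1# b d)) (sym (⁻¹-∙-comm _ _))) ⟩
    (A + C) + (- B + - D)             ≈⟨ solve 4 (λ A C B D → ((A :+ C) :+ (B :+ D)) := ((A :+ B) :+ (C :+ D))) refl A C (- B) (- D) ⟩
    (A - B) + (C - D)                 ∎
    where
    A B C D : Carrier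
    A = a ×′ 1#
    B = b ×′ 1#
    C = c ×′ 1#
    D = d ×′ 1#

  *-homo : ∀ p q → ⟦ RawRing._*_ ℤ-differences p q ⟧ ≈ ⟦ p ⟧ * ⟦ q ⟧
  *-homo (a , b) (c , d) = begin
    (a ℕ.* c ℕ.+ b ℕ.* d) ×′ 1# - (a ℕ.* d ℕ.+ b ℕ.* c) ×′ 1#
      ≈⟨ +-cong (embed-+* a c b d) (trans (-‿cong (embed-+* a d b c)) (sym (⁻¹-∙-comm _ _))) ⟩
    (A * C + B * D) + (- (A * D) + - (B * C))
      ≈⟨ +-cong (+-congˡ (sym (neg*neg B D))) (+-cong (-‿distribʳ-* A D) (-‿distribˡ-* B C)) ⟩
    (A * C + - B * - D) + (A * - D + - B * C)
      ≈⟨ solve 4 (λ A B C D → ((A :* C :+ B :* D) :+ (A :* D :+ B :* C)) := ((A :+ B) :* (C :+ D))) refl A (- B) C (- D) ⟩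
    (A - B) * (C - D) ∎
    where
    A B C D : Carrier
    A = a ×′ 1#
    B = b ×′ 1#
    C = c ×′ 1#
    D = d ×′ 1#
    neg*neg : ∀ x y → - x * - y ≈ x * y
    neg*neg x y = trans (sym (-‿distribˡ-* x (- y))) (trans (-‿cong (sym (-‿distribʳ-* x y))) (⁻¹-involutive _))
    embed-+* : ∀ m n o p → (m ℕ.* n ℕ.+ o ℕ.* p) ×′ 1# ≈ (m ×′ 1#) * (n ×′ 1#) + (o ×′ 1#) * (p ×′ 1#)
    embed-+* m n o p = trans (×-homo-+ 1# (m ℕ.* n) (o ℕ.* p)) (+-cong (×1-homo-* m n) (×1-homo-* o p))

  -‿homo : ∀ p → ⟦ RawRing.-_ ℤ-differences p ⟧ ≈ - ⟦ p ⟧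
  -‿homo (a , b) = begin
    b ×′ 1# - a ×′ 1#         ≈⟨ +-comm _ _ ⟩
    - (a ×′ 1#) + b ×′ 1#     ≈⟨ +-congˡ (⁻¹-involutive _) ⟨
    - (a ×′ 1#) + - - (b ×′ 1#) ≈⟨ ⁻¹-∙-comm _ _ ⟩
    - (a ×′ 1# - b ×′ 1#)     ∎

  ℤ-differences⟶R : ℤ-differences -Raw-AlmostCommutative⟶ fromCommutativeRing R
  ℤ-differences⟶R = record
    { ⟦_⟧    = ⟦_⟧
    ; +-homo = +-homo
    ; *-homo = *-homo
    ; -‿homo = -‿homo
    ; 0-homo = -‿inverseʳ 0#
    ; 1-homo = trans (+-congˡ -0#≈0#) (trans (+-identityʳ _) (+-identityʳ 1#))
    }

  ⟦⟧-dec : WeaklyDecidable (λ p q → ⟦ p ⟧ ≈ ⟦ q ⟧)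
  ⟦⟧-dec (a , b) (c , d) with a ℕ.+ d ℕP.≟ c ℕ.+ b
  ... | no _        = nothing
  ... | yes a+d≡c+b = just (difference-cong (begin
    a ×′ 1# + d ×′ 1#   ≈⟨ ×-homo-+ 1# a d ⟨
    (a ℕ.+ d) ×′ 1#     ≡⟨ ≡.cong (_×′ 1#) a+d≡c+b ⟩
    (c ℕ.+ b) ×′ 1#     ≈⟨ ×-homo-+ 1# c b ⟩
    c ×′ 1# + b ×′ 1#   ∎))

  open Algebra.Solver.Ring ℤ-differences (fromCommutativeRing R) ℤ-differences⟶R ⟦⟧-dec public
    using (solve; _:=_; _:+_; _:*_; _:-_; :-_)

≢fromℕ⇒inject₁ : ∀ {m} (k : Fin (suc m)) → k ≢ fromℕ m → ∃ λ k′ → inject₁ k′ ≡ k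
≢fromℕ⇒inject₁ {m} k k≢m = lower₁ k m≢k , inject₁-lower₁ k m≢k
  where
  m≢k : m ≢ toℕ k
  m≢k m≡k = k≢m (toℕ-injective (≡.trans (≡.sym m≡k) (≡.sym (toℕ-fromℕ m))))

inject₁≢suc : ∀ {n} (k : Fin n) → inject₁ k ≢ suc k
inject₁≢suc k eq = ℕP.1+n≢n (≡.trans (≡.sym (≡.cong toℕ eq)) (toℕ-inject₁ k))

module _ {c ℓ} (F : Field c ℓ) where
  open FieldDefs F
  open Field F
    using (_-_; setoid; refl; sym; trans; reflexive; +-cong; +-congˡ; +-congʳ; *-cong; *-congˡ; -‿cong;
           zeroˡ; zeroʳ; +-identityʳ; *-identityˡ; *-identityʳ; *-assoc; *-comm; distribˡ; inverse;
           commutativeRing; semiring; ring; +-group)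
  open import Algebra.Properties.Semiring.Sum semiring
    using (sum; sum-cong-≋; sum-cong-≗; ∑-distrib-+; ∑-comm; sum-remove; sum-init-last;
           *-distribˡ-sum; sum-replicate-zero)
  open import Algebra.Properties.Ring ring using (-1*x≈-x; -‿distribˡ-*; -‿distribʳ-*)
  open import Algebra.Properties.Group +-group using (x∙y⁻¹≈ε⇒x≈y)
  open CommutativeRingSolver commutativeRing using (solve; _:=_; _:+_; _:*_; _:-_; :-_)
  open SetoidReasoning setoid

  x*e≈y*e+f⇒[x-y]*e≈f : ∀ {x y e f} → x * e ≈ y * e + f → (x - y) * e ≈ f
  x*e≈y*e+f⇒[x-y]*e≈f {x} {y} {e} {f} xe≈ye+f = begin
    (x - y) * e          ≈⟨ solve 3 (λ x y e → ((x :- y) :* e) := (x :* e :- y :* e)) refl x y e ⟩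
    x * e - y * e        ≈⟨ +-cong xe≈ye+f refl ⟩
    (y * e + f) - y * e  ≈⟨ solve 3 (λ y e f → ((y :* e :+ f) :- y :* e) := f) refl y e f ⟩
    f                    ∎

  -- Finite sums

  ΣF≡sum : ∀ {n} (f : Fin n → Carrier) → ΣF f ≡ sum f
  ΣF≡sum {zero}  f = ≡.refl
  ΣF≡sum {suc n} f = ≡.cong (f zero +_) (ΣF≡sum (f ∘ suc))

  ΣF≈sum : ∀ {n} (f : Fin n → Carrier) → ΣF f ≈ sum f
  ΣF≈sum f = reflexive (ΣF≡sum f)

  ΣF-cong : ∀ {n} {f g : Fin n → Carrier} → (∀ i → f i ≈ g i) → ΣF f ≈ ΣF g
  ΣF-cong {f = f} {g} f≈g = trans (ΣF≈sum f) (trans (sum-cong-≋ f≈g) (sym (ΣF≈sum g)))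

  ΣF-distrib-+ : ∀ {n} (f g : Fin n → Carrier) → ΣF (λ i → f i + g i) ≈ ΣF f + ΣF g
  ΣF-distrib-+ f g = begin
    ΣF (λ i → f i + g i) ≈⟨ ΣF≈sum (λ i → f i + g i) ⟩
    sum (λ i → f i + g i) ≈⟨ ∑-distrib-+ f g ⟩
    sum f + sum g         ≈⟨ +-cong (ΣF≈sum f) (ΣF≈sum g) ⟨
    ΣF f + ΣF g           ∎

  *-distribˡ-ΣF : ∀ {n} x (f : Fin n → Carrier) → x * ΣF f ≈ ΣF (λ i → x * f i)
  *-distribˡ-ΣF x f = begin
    x * ΣF f                ≈⟨ *-congˡ (ΣF≈sum f) ⟩
    x * sum f               ≈⟨ *-distribˡ-sum x f ⟩
    sum (λ i → x * f i)     ≈⟨ ΣF≈sum (λ i → x * f i) ⟨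
    ΣF (λ i → x * f i)      ∎

  -‿distrib-ΣF : ∀ {n} (f : Fin n → Carrier) → - ΣF f ≈ ΣF (λ i → - f i)
  -‿distrib-ΣF f = begin
    - ΣF f                  ≈⟨ -1*x≈-x _ ⟨
    - 1# * ΣF f             ≈⟨ *-distribˡ-ΣF (- 1#) f ⟩
    ΣF (λ i → - 1# * f i)   ≈⟨ ΣF-cong (λ i → -1*x≈-x (f i)) ⟩
    ΣF (λ i → - f i)        ∎

  ΣF-comm : ∀ {m n} (f : Fin m → Fin n → Carrier) →
            ΣF (λ i → ΣF (f i)) ≈ ΣF (λ j → ΣF (λ i → f i j))
  ΣF-comm f = begin
    ΣF (λ i → ΣF (f i))              ≈⟨ ΣF≈sum (λ i → ΣF (f i)) ⟩
    sum (λ i → ΣF (f i))             ≡⟨ sum-cong-≗ (λ i → ΣF≡sum (f i)) ⟩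
    sum (λ i → sum (f i))            ≈⟨ ∑-comm f ⟩
    sum (λ j → sum (λ i → f i j))    ≡⟨ sum-cong-≗ (λ j → ΣF≡sum (λ i → f i j)) ⟨
    sum (λ j → ΣF (λ i → f i j))     ≈⟨ ΣF≈sum (λ j → ΣF (λ i → f i j)) ⟨
    ΣF (λ j → ΣF (λ i → f i j))      ∎

  ΣF-zero : ∀ {n} (f : Fin n → Carrier) → (∀ i → f i ≈ 0#) → ΣF f ≈ 0#
  ΣF-zero {n} f f≈0 = trans (ΣF≈sum f) (trans (sum-cong-≋ f≈0) (sum-replicate-zero n))

  ΣF-init-last : ∀ {n} (f : Fin (suc n) → Carrier) → ΣF f ≈ ΣF (f ∘ inject₁) + f (fromℕ n)
  ΣF-init-last f =
    trans (ΣF≈sum f) (trans (sum-init-last f) (+-cong (sym (ΣF≈sum (f ∘ inject₁))) refl))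

  ΣF-remove : ∀ {n} (f : Fin (suc n) → Carrier) k → ΣF f ≈ f k + ΣF (removeAt f k)
  ΣF-remove f k = trans (ΣF≈sum f) (trans (sum-remove f) (+-congˡ (sym (ΣF≈sum (removeAt f k)))))

  ΣF-single : ∀ {n} (f : Fin n → Carrier) k → (∀ i → i ≢ k → f i ≈ 0#) → ΣF f ≈ f k
  ΣF-single {suc n} f k f≈0 = begin
    ΣF f                   ≈⟨ ΣF-remove f k ⟩
    f k + ΣF (removeAt f k) ≈⟨ +-congˡ (ΣF-zero _ (λ i → f≈0 (punchIn k i) (punchInᵢ≢i k i))) ⟩
    f k + 0#               ≈⟨ +-identityʳ (f k) ⟩
    f k                    ∎

  ΣF-pair : ∀ {n} (f : Fin n → Carrier) {k l} → k ≢ l → (∀ i → i ≢ k → i ≢ l → f i ≈ 0#) →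
            ΣF f ≈ f k + f l
  ΣF-pair {suc n} f {k} {l} k≢l f≈0 = begin
    ΣF f                    ≈⟨ ΣF-remove f k ⟩
    f k + ΣF (removeAt f k) ≈⟨ +-congˡ (ΣF-single (removeAt f k) (punchOut k≢l) vanishes) ⟩
    f k + f (punchIn k (punchOut k≢l)) ≡⟨ ≡.cong (λ i → f k + f i) (punchIn-punchOut k≢l) ⟩
    f k + f l               ∎
    where
    vanishes : ∀ i → i ≢ punchOut k≢l → f (punchIn k i) ≈ 0#
    vanishes i i≢l′ = f≈0 (punchIn k i) (punchInᵢ≢i k i)
      (λ eq → i≢l′ (punchIn-injective k i _ (≡.trans eq (≡.sym (punchIn-punchOut k≢l)))))

  ΣF-replace : ∀ {n} (f g : Fin n → Carrier) k → (∀ i → i ≢ k → f i ≈ g i) →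
               ΣF f + g k ≈ ΣF g + f k
  ΣF-replace {suc n} f g k f≈g = begin
    ΣF f + g k                      ≈⟨ +-cong (ΣF-remove f k) refl ⟩
    (f k + ΣF (removeAt f k)) + g k ≈⟨ +-cong (+-congˡ (ΣF-cong (λ i → f≈g (punchIn k i) (punchInᵢ≢i k i)))) refl ⟩
    (f k + ΣF (removeAt g k)) + g k ≈⟨ solve 3 (λ a b c → ((a :+ b) :+ c) := ((c :+ b) :+ a)) refl (f k) _ (g k) ⟩
    (g k + ΣF (removeAt g k)) + f k ≈⟨ +-cong (ΣF-remove g k) refl ⟨
    ΣF g + f k                      ∎

  -- Matrices acting on column vectors

  ΣM-entry : ∀ {N n} (f : Fin n → Mat N) i j → ΣM f i j ≡ ΣF (λ k → f k i j)
  ΣM-entry {n = zero}  f i j = ≡.refl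
  ΣM-entry {n = suc n} f i j = ≡.cong (f zero i j +_) (ΣM-entry (f ∘ suc) i j)

  ΣV : ∀ {N m} → (Fin m → Vec N) → Vec N
  ΣV u a = ΣF (λ j → u j a)

  col : ∀ {N} → Mat N → Fin N → Vec N
  col P k a = P a k

  module _ {N} (X : Mat N) where

    ·-cong : ∀ {v w : Vec N} → v ≈V w → (X · v) ≈V (X · w)
    ·-cong v≈w a = ΣF-cong (λ k → *-congˡ (v≈w k))

    ·-• : ∀ x (v : Vec N) → (X · (x • v)) ≈V (x • (X · v))
    ·-• x v a = begin
      ΣF (λ k → X a k * (x * v k)) ≈⟨ ΣF-cong (λ k → solve 3 (λ y x v → (y :* (x :* v)) := (x :* (y :* v))) refl (X a k) x (v k)) ⟩
      ΣF (λ k → x * (X a k * v k)) ≈⟨ *-distribˡ-ΣF x (λ k → X a k * v k) ⟨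
      x * (X · v) a                ∎

    ·-+ : ∀ (v w : Vec N) → (X · (λ a → v a + w a)) ≈V (λ a → (X · v) a + (X · w) a)
    ·-+ v w a = trans (ΣF-cong (λ k → distribˡ (X a k) (v k) (w k))) (ΣF-distrib-+ (λ k → X a k * v k) (λ k → X a k * w k))

    ·-neg : ∀ (v : Vec N) → (X · (λ a → - v a)) ≈V (λ a → - (X · v) a)
    ·-neg v a = trans (ΣF-cong (λ k → sym (-‿distribʳ-* (X a k) (v k)))) (sym (-‿distrib-ΣF (λ k → X a k * v k)))

    ·-ΣV : ∀ {m} (u : Fin m → Vec N) → (X · ΣV u) ≈V ΣV (λ j → X · u j)
    ·-ΣV u a = trans (ΣF-cong (λ k → *-distribˡ-ΣF (X a k) (λ j → u j k))) (ΣF-comm (λ k j → X a k * u j k))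

    ·-𝟎 : (X · 𝟎V) ≈V 𝟎V
    ·-𝟎 a = ΣF-zero (λ k → X a k * 0#) (λ k → zeroʳ (X a k))

  I-diagonal : ∀ {N} (i : Fin N) → I i i ≡ 1#
  I-diagonal i with toℕ i ℕ.≟ toℕ i
  ... | yes _   = ≡.refl
  ... | no i≢i  = ⊥-elim (i≢i ≡.refl)

  I-off-diagonal : ∀ {N} {i j : Fin N} → i ≢ j → I i j ≡ 0#
  I-off-diagonal {i = i} {j} i≢j with toℕ i ℕ.≟ toℕ j
  ... | yes i≡j = ⊥-elim (i≢j (toℕ-injective i≡j))
  ... | no _    = ≡.refl

  I·v≈v : ∀ {N} (v : Vec N) → (I · v) ≈V v
  I·v≈v v a = begin
    ΣF (λ m → I a m * v m) ≈⟨ ΣF-single (λ m → I a m * v m) a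
                                (λ m m≢a → trans (*-cong (reflexive (I-off-diagonal (m≢a ∘ ≡.sym))) refl) (zeroˡ (v m))) ⟩
    I a a * v a            ≡⟨ ≡.cong (_* v a) (I-diagonal a) ⟩
    1# * v a               ≈⟨ *-identityˡ (v a) ⟩
    v a                    ∎

  ·-col-I : ∀ {N} (X : Mat N) b → (X · col I b) ≈V col X b
  ·-col-I X b a = begin
    ΣF (λ m → X a m * I m b) ≈⟨ ΣF-single (λ m → X a m * I m b) b
                                  (λ m m≢b → trans (*-congˡ (reflexive (I-off-diagonal m≢b))) (zeroʳ (X a m))) ⟩
    X a b * I b b            ≡⟨ ≡.cong (X a b *_) (I-diagonal b) ⟩
    X a b * 1#               ≈⟨ *-identityʳ (X a b) ⟩
    X a b                    ∎

  columns-span : ∀ {N} {P Q : Mat N} → (P ⊙ Q) ≈M I → ∀ v → v ≈V ΣV (λ k → (Q · v) k • col P k)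
  columns-span {N} {P} {Q} PQ≈I v a = begin
    v a                                      ≈⟨ I·v≈v v a ⟨
    ΣF (λ m → I a m * v m)                   ≈⟨ ΣF-cong (λ m → *-cong (sym (PQ≈I a m)) refl) ⟩
    ΣF (λ m → ΣF (λ k → P a k * Q k m) * v m) ≈⟨ ΣF-cong (λ m → trans (*-comm _ (v m)) (*-distribˡ-ΣF (v m) (λ k → P a k * Q k m))) ⟩
    ΣF (λ m → ΣF (λ k → v m * (P a k * Q k m))) ≈⟨ ΣF-comm (λ m k → v m * (P a k * Q k m)) ⟩
    ΣF (λ k → ΣF (λ m → v m * (P a k * Q k m)))
      ≈⟨ ΣF-cong (λ k → ΣF-cong (λ m → solve 3 (λ v p q → (v :* (p :* q)) := (p :* (q :* v))) refl (v m) (P a k) (Q k m))) ⟩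
    ΣF (λ k → ΣF (λ m → P a k * (Q k m * v m))) ≈⟨ ΣF-cong (λ k → *-distribˡ-ΣF (P a k) (λ m → Q k m * v m)) ⟨
    ΣF (λ k → P a k * (Q · v) k)             ≈⟨ ΣF-cong (λ k → *-comm (P a k) ((Q · v) k)) ⟩
    ΣF (λ k → (Q · v) k * P a k)             ∎

  -- Bidiagonal matrices

  module _ {d} (t : Fin (suc d) → Carrier) where

    lowerBidiag-diagonal : ∀ i → lowerBidiag t i i ≡ t i
    lowerBidiag-diagonal i with toℕ i ℕ.≟ toℕ i
    ... | yes _  = ≡.refl
    ... | no i≢i = ⊥-elim (i≢i ≡.refl)

    lowerBidiag-subdiagonal : ∀ {i j} → toℕ i ≡ suc (toℕ j) → lowerBidiag t i j ≡ 1#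
    lowerBidiag-subdiagonal {i} {j} i≡1+j with toℕ i ℕ.≟ toℕ j
    ... | yes i≡j = ⊥-elim (ℕP.1+n≢n (≡.trans (≡.sym i≡1+j) i≡j))
    ... | no _ with toℕ i ℕ.≟ suc (toℕ j)
    ...   | yes _    = ≡.refl
    ...   | no i≢1+j = ⊥-elim (i≢1+j i≡1+j)

    lowerBidiag-elsewhere : ∀ {i j} → toℕ i ≢ toℕ j → toℕ i ≢ suc (toℕ j) → lowerBidiag t i j ≡ 0#
    lowerBidiag-elsewhere {i} {j} i≢j i≢1+j with toℕ i ℕ.≟ toℕ j
    ... | yes i≡j = ⊥-elim (i≢j i≡j)
    ... | no _ with toℕ i ℕ.≟ suc (toℕ j)
    ...   | yes i≡1+j = ⊥-elim (i≢1+j i≡1+j)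
    ...   | no _      = ≡.refl

    lowerBidiag-last-column : ∀ (x : Fin (suc d) → Carrier) →
      ΣF (λ m → x m * lowerBidiag t m (fromℕ d)) ≈ t (fromℕ d) * x (fromℕ d)
    lowerBidiag-last-column x = begin
      ΣF (λ m → x m * lowerBidiag t m (fromℕ d)) ≈⟨ ΣF-single _ (fromℕ d) (λ m m≢d →
          trans (*-congˡ (reflexive (lowerBidiag-elsewhere (m≢d ∘ toℕ-injective) (beyond m)))) (zeroʳ (x m))) ⟩
      x (fromℕ d) * lowerBidiag t (fromℕ d) (fromℕ d) ≡⟨ ≡.cong (x (fromℕ d) *_) (lowerBidiag-diagonal (fromℕ d)) ⟩
      x (fromℕ d) * t (fromℕ d)                     ≈⟨ *-comm _ _ ⟩
      t (fromℕ d) * x (fromℕ d)                     ∎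
      where
      beyond : ∀ m → toℕ m ≢ suc (toℕ (fromℕ d))
      beyond m eq = ℕP.<-irrefl (≡.trans eq (≡.cong suc (toℕ-fromℕ d))) (toℕ<n m)

    lowerBidiag-column : ∀ (x : Fin (suc d) → Carrier) (k : Fin d) →
      ΣF (λ m → x m * lowerBidiag t m (inject₁ k)) ≈ t (inject₁ k) * x (inject₁ k) + x (suc k)
    lowerBidiag-column x k = begin
      ΣF (λ m → x m * lowerBidiag t m (inject₁ k))
        ≈⟨ ΣF-pair _ (inject₁≢suc k) (λ m m≢k m≢1+k →
             trans (*-congˡ (reflexive (lowerBidiag-elsewhere (m≢k ∘ toℕ-injective) (m≢1+k ∘ toℕ-injective ∘ at-suc)))) (zeroʳ (x m))) ⟩
      x (inject₁ k) * lowerBidiag t (inject₁ k) (inject₁ k) + x (suc k) * lowerBidiag t (suc k) (inject₁ k)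
        ≡⟨ ≡.cong₂ (λ a b → x (inject₁ k) * a + x (suc k) * b)
                   (lowerBidiag-diagonal (inject₁ k)) (lowerBidiag-subdiagonal (≡.cong suc (≡.sym (toℕ-inject₁ k)))) ⟩
      x (inject₁ k) * t (inject₁ k) + x (suc k) * 1#
        ≈⟨ +-cong (*-comm _ _) (*-identityʳ _) ⟩
      t (inject₁ k) * x (inject₁ k) + x (suc k) ∎
      where
      at-suc : ∀ {m} → toℕ m ≡ suc (toℕ (inject₁ k)) → toℕ m ≡ toℕ (suc k)
      at-suc eq = ≡.trans eq (≡.cong suc (toℕ-inject₁ k))

    module _ (φ : Fin d → Carrier) where

      upperBidiag-diagonal : ∀ i → upperBidiag t φ i i ≡ t i
      upperBidiag-diagonal i with toℕ i ℕ.≟ toℕ i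
      ... | yes _  = ≡.refl
      ... | no i≢i = ⊥-elim (i≢i ≡.refl)

      upperBidiag-superdiagonal : ∀ {i} (k : Fin d) → toℕ i ≡ toℕ k → upperBidiag t φ i (suc k) ≡ φ k
      upperBidiag-superdiagonal {i} k i≡k with toℕ i ℕ.≟ suc (toℕ k)
      ... | yes i≡1+k = ⊥-elim (ℕP.1+n≢n (≡.trans (≡.sym i≡1+k) i≡k))
      ... | no _ with toℕ i ℕ.≟ toℕ k
      ...   | yes _  = ≡.refl
      ...   | no i≢k = ⊥-elim (i≢k i≡k)

      upperBidiag-first-column-elsewhere : ∀ {i} → toℕ i ≢ 0 → upperBidiag t φ i zero ≡ 0#
      upperBidiag-first-column-elsewhere {i} i≢0 with toℕ i ℕ.≟ 0
      ... | yes i≡0 = ⊥-elim (i≢0 i≡0)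
      ... | no _    = ≡.refl

      upperBidiag-elsewhere : ∀ {i} (k : Fin d) → toℕ i ≢ suc (toℕ k) → toℕ i ≢ toℕ k →
                              upperBidiag t φ i (suc k) ≡ 0#
      upperBidiag-elsewhere {i} k i≢1+k i≢k with toℕ i ℕ.≟ suc (toℕ k)
      ... | yes i≡1+k = ⊥-elim (i≢1+k i≡1+k)
      ... | no _ with toℕ i ℕ.≟ toℕ k
      ...   | yes i≡k = ⊥-elim (i≢k i≡k)
      ...   | no _    = ≡.refl

      upperBidiag-first-column : ∀ (x : Fin (suc d) → Carrier) →
        ΣF (λ m → x m * upperBidiag t φ m zero) ≈ t zero * x zero
      upperBidiag-first-column x = begin
        ΣF (λ m → x m * upperBidiag t φ m zero) ≈⟨ ΣF-single _ zero (λ m m≢0 →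
            trans (*-congˡ (reflexive (upperBidiag-first-column-elsewhere (m≢0 ∘ toℕ-injective)))) (zeroʳ (x m))) ⟩
        x zero * upperBidiag t φ zero zero       ≡⟨ ≡.cong (x zero *_) (upperBidiag-diagonal zero) ⟩
        x zero * t zero                         ≈⟨ *-comm _ _ ⟩
        t zero * x zero                         ∎

      upperBidiag-column : ∀ (x : Fin (suc d) → Carrier) (k : Fin d) →
        ΣF (λ m → x m * upperBidiag t φ m (suc k)) ≈ t (suc k) * x (suc k) + φ k * x (inject₁ k)
      upperBidiag-column x k = begin
        ΣF (λ m → x m * upperBidiag t φ m (suc k))
          ≈⟨ ΣF-pair _ (inject₁≢suc k ∘ ≡.sym) (λ m m≢1+k m≢k →
               trans (*-congˡ (reflexive (upperBidiag-elsewhere k (m≢1+k ∘ toℕ-injective)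
                                                               (m≢k ∘ toℕ-injective ∘ at-inject₁)))) (zeroʳ (x m))) ⟩
        x (suc k) * upperBidiag t φ (suc k) (suc k) + x (inject₁ k) * upperBidiag t φ (inject₁ k) (suc k)
          ≡⟨ ≡.cong₂ (λ a b → x (suc k) * a + x (inject₁ k) * b)
                     (upperBidiag-diagonal (suc k)) (upperBidiag-superdiagonal k (toℕ-inject₁ k)) ⟩
        x (suc k) * t (suc k) + x (inject₁ k) * φ k
          ≈⟨ +-cong (*-comm _ _) (*-comm _ _) ⟩
        t (suc k) * x (suc k) + φ k * x (inject₁ k) ∎
        where
        at-inject₁ : ∀ {m} → toℕ m ≡ toℕ k → toℕ m ≡ toℕ (inject₁ k)
        at-inject₁ eq = ≡.trans eq (≡.sym (toℕ-inject₁ k))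

  -- Diagonalisation with respect to a triangular basis

  module Diagonalisation {N} (M : Mat N) (t : Fin N → Carrier)
                         (t-injective : ∀ i j → t i ≈ t j → i ≡ j) where

    IsEigenFamily : (Fin N → Vec N) → Set ℓ
    IsEigenFamily u = ∀ j → (M · u j) ≈V (t j • u j)

    •-eigenvector : ∀ {θ v} s → (M · v) ≈V (θ • v) → (M · (s • v)) ≈V (θ • (s • v))
    •-eigenvector {θ} {v} s Mv≈θv a = begin
      (M · (s • v)) a ≈⟨ ·-• M s v a ⟩
      s * (M · v) a   ≈⟨ *-congˡ (Mv≈θv a) ⟩
      s * (θ * v a)   ≈⟨ solve 3 (λ s θ v → (s :* (θ :* v)) := (θ :* (s :* v))) refl s θ (v a) ⟩
      θ * (s * v a)   ∎

    module _ (E : Fin N → Mat N) (E-primitive : ∀ i → IsPrimitiveIdempotent M (t i) (E i)) where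

      E-picks-component : ∀ {u} → IsEigenFamily u → ∀ i → (E i · ΣV u) ≈V u i
      E-picks-component {u} u-eigen i a = begin
        (E i · ΣV u) a          ≈⟨ ·-ΣV (E i) u a ⟩
        ΣF (λ j → (E i · u j) a) ≈⟨ ΣF-single (λ j → (E i · u j) a) i (λ j j≢i → kills j j≢i a) ⟩
        (E i · u i) a           ≈⟨ fixes a ⟩
        u i a                   ∎
        where
        fixes : (E i · u i) ≈V u i
        fixes = proj₁ (proj₂ (E-primitive i)) (u i) (u-eigen i)
        kills : ∀ j → j ≢ i → (E i · u j) ≈V 𝟎V
        kills j j≢i = proj₂ (proj₂ (E-primitive i)) (t j) (u j) (j≢i ∘ t-injective j i)
                              (proj₁ (E-primitive j)) (u-eigen j)

    module TriangularBasis
      (q : Fin N → Vec N) (root : Fin N) (rank : Fin N → ℕ)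
      (q-root-eigen : (M · q root) ≈V (t root • q root))
      (q-step : ∀ k → k ≢ root → ∃ λ k′ → rank k′ ℕ.< rank k × ∃ λ s →
                  (M · q k) ≈V (λ a → t k * q k a + s * q k′ a))
      (q-spans : ∀ v → ∃ λ (x : Fin N → Carrier) → v ≈V ΣV (λ k → x k • q k))
      where

      record EigenDecomposition (v : Vec N) : Set (c ⊔ ℓ) where
        field
          component       : Fin N → Vec N
          component-eigen : IsEigenFamily component
          root-scale      : Carrier
          root-component  : component root ≈V (root-scale • q root)
          sums-to         : v ≈V ΣV component
      open EigenDecomposition

      VanishesAbove : ∀ {v} → ℕ → EigenDecomposition v → Set ℓ
      VanishesAbove r D = ∀ j → r ℕ.< rank j → component D j ≈V 𝟎V

      decomposition-• : ∀ {v} s → EigenDecomposition v → EigenDecomposition (s • v)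
      decomposition-• s D = record
        { component       = λ j → s • component D j
        ; component-eigen = λ j → •-eigenvector s (component-eigen D j)
        ; root-scale      = s * root-scale D
        ; root-component  = λ a → trans (*-congˡ (root-component D a)) (sym (*-assoc _ _ _))
        ; sums-to         = λ a → trans (*-congˡ (sums-to D a)) (*-distribˡ-ΣF s (λ j → component D j a))
        }

      decomposition-•-vanishes : ∀ {v r} s (D : EigenDecomposition v) → VanishesAbove r D → VanishesAbove r (decomposition-• s D)
      decomposition-•-vanishes s D D-vanishes j r<j a = trans (*-congˡ (D-vanishes j r<j a)) (zeroʳ s)

      decomposition-ΣV : ∀ {m} {vs : Fin m → Vec N} → (∀ i → EigenDecomposition (vs i)) → EigenDecomposition (ΣV vs)
      decomposition-ΣV {m} {vs} D = record
        { component       = λ j → ΣV (λ i → component (D i) j)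
        ; component-eigen = λ j a → begin
            (M · ΣV (λ i → component (D i) j)) a   ≈⟨ ·-ΣV M (λ i → component (D i) j) a ⟩
            ΣF (λ i → (M · component (D i) j) a)  ≈⟨ ΣF-cong (λ i → component-eigen (D i) j a) ⟩
            ΣF (λ i → t j * component (D i) j a)  ≈⟨ *-distribˡ-ΣF (t j) (λ i → component (D i) j a) ⟨
            t j * ΣV (λ i → component (D i) j) a  ∎
        ; root-scale      = ΣF (λ i → root-scale (D i))
        ; root-component  = λ a → begin
            ΣF (λ i → component (D i) root a)    ≈⟨ ΣF-cong (λ i → trans (root-component (D i) a) (*-comm _ _)) ⟩
            ΣF (λ i → q root a * root-scale (D i)) ≈⟨ *-distribˡ-ΣF (q root a) (λ i → root-scale (D i)) ⟨
            q root a * ΣF (λ i → root-scale (D i)) ≈⟨ *-comm _ _ ⟩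
            ΣF (λ i → root-scale (D i)) * q root a ∎
        ; sums-to         = λ a → begin
            ΣF (λ i → vs i a)                               ≈⟨ ΣF-cong (λ i → sums-to (D i) a) ⟩
            ΣF (λ i → ΣF (λ j → component (D i) j a))       ≈⟨ ΣF-comm (λ i j → component (D i) j a) ⟩
            ΣF (λ j → ΣF (λ i → component (D i) j a))       ∎
        }

      decomposition-cong : ∀ {v w} → v ≈V w → EigenDecomposition v → EigenDecomposition w
      decomposition-cong v≈w D = record
        { component = component D ; component-eigen = component-eigen D
        ; root-scale = root-scale D ; root-component = root-component D
        ; sums-to = λ a → trans (sym (v≈w a)) (sums-to D a) }

      root-decomposition : Σ (EigenDecomposition (q root)) (VanishesAbove (rank root))
      root-decomposition = record
        { component       = u
        ; component-eigen = eigen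
        ; root-scale      = 1#
        ; root-component  = λ a → trans (u-root a) (sym (*-identityˡ (q root a)))
        ; sums-to         = λ a → sym (trans (ΣF-single (λ j → u j a) root (λ j j≢root → u-off j j≢root a)) (u-root a))
        } , λ j root<j → u-off j (λ { ≡.refl → ℕP.<-irrefl ≡.refl root<j })
        where
        u : Fin N → Vec N
        u = updateAt (λ _ → 𝟎V) root (λ _ → q root)

        u-root : u root ≈V q root
        u-root a = reflexive (≡.cong-app (updateAt-updates root (λ _ → 𝟎V)) a)

        u-off : ∀ j → j ≢ root → u j ≈V 𝟎V
        u-off j j≢root a = reflexive (≡.cong-app (updateAt-minimal j root (λ _ → 𝟎V) j≢root) a)

        eigen : IsEigenFamily u
        eigen j a with j ≟ root
        ... | yes ≡.refl = begin
          (M · u root) a      ≈⟨ ·-cong M u-root a ⟩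
          (M · q root) a      ≈⟨ q-root-eigen a ⟩
          t root * q root a   ≈⟨ *-congˡ (u-root a) ⟨
          t root * u root a   ∎
        ... | no j≢root  = begin
          (M · u j) a   ≈⟨ ·-cong M (u-off j j≢root) a ⟩
          (M · 𝟎V) a    ≈⟨ ·-𝟎 M a ⟩
          0#            ≈⟨ zeroʳ (t j) ⟨
          t j * 0#      ≈⟨ *-congˡ (u-off j j≢root a) ⟨
          t j * u j a   ∎

      -- Writing y = Σ u_j with u_k = 0, the vector w = q_k − Σ_{j≠k} u_j / (t_j − t_k) is a
      -- t_k-eigenvector, so q_k = w + Σ_{j≠k} u_j / (t_j − t_k) decomposes q_k.
      module Extension {k y r} (k≢root : k ≢ root) (r<k : r ℕ.< rank k)
                       (D : EigenDecomposition y) (D-vanishes : VanishesAbove r D)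
                       (Mqk : (M · q k) ≈V (λ a → t k * q k a + y a)) where

        u : Fin N → Vec N
        u = component D

        u-k≈0 : u k ≈V 𝟎V
        u-k≈0 = D-vanishes k r<k

        gap-nonzero : ∀ {j} → j ≢ k → ¬ (t j - t k ≈ 0#)
        gap-nonzero {j} j≢k gap≈0 = j≢k (t-injective j k (x∙y⁻¹≈ε⇒x≈y (t j) (t k) gap≈0))

        ι : Fin N → Carrier
        ι j with j ≟ k
        ... | yes _   = 0#
        ... | no j≢k  = proj₁ (inverse (t j - t k) (gap-nonzero j≢k))

        z : Fin N → Vec N
        z j = ι j • u j

        gap-z : ∀ j a → (t j - t k) * z j a ≈ u j a
        gap-z j a with j ≟ k
        ... | yes ≡.refl = trans (*-congˡ (zeroˡ (u k a))) (trans (zeroʳ _) (sym (u-k≈0 a)))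
        ... | no j≢k     = begin
          (t j - t k) * (ι′ * u j a) ≈⟨ *-assoc _ _ _ ⟨
          (t j - t k) * ι′ * u j a   ≈⟨ *-cong (proj₂ (inverse (t j - t k) (gap-nonzero j≢k))) refl ⟩
          1# * u j a                 ≈⟨ *-identityˡ (u j a) ⟩
          u j a                      ∎
          where
          ι′ : Carrier
          ι′ = proj₁ (inverse (t j - t k) (gap-nonzero j≢k))

        z-k≈0 : z k ≈V 𝟎V
        z-k≈0 a = trans (*-congˡ (u-k≈0 a)) (zeroʳ (ι k))

        w : Vec N
        w a = q k a - ΣV z a

        w-eigen : (M · w) ≈V (t k • w)
        w-eigen a = begin
          (M · w) a                                ≈⟨ ·-+ M (q k) (λ b → - ΣV z b) a ⟩
          (M · q k) a + (M · (λ b → - ΣV z b)) a   ≈⟨ +-cong (Mqk a) (·-neg M (ΣV z) a) ⟩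
          (t k * q k a + y a) - (M · ΣV z) a       ≈⟨ +-cong (+-congˡ y≈) (-‿cong Mz≈) ⟩
          (t k * q k a + (T - t k * S)) - T        ≈⟨ solve 4 (λ θ x T S → ((θ :* x :+ (T :- θ :* S)) :- T) := (θ :* (x :- S)))
                                                            refl (t k) (q k a) T S ⟩
          t k * w a                                ∎
          where
          S T : Carrier
          S = ΣV z a
          T = ΣF (λ j → t j * z j a)
          Mz≈ : (M · ΣV z) a ≈ T
          Mz≈ = trans (·-ΣV M z a) (ΣF-cong (λ j → •-eigenvector (ι j) (component-eigen D j) a))
          y≈ : y a ≈ T - t k * S
          y≈ = begin
            y a                                      ≈⟨ sums-to D a ⟩
            ΣF (λ j → u j a)                         ≈⟨ ΣF-cong (λ j → gap-z j a) ⟨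
            ΣF (λ j → (t j - t k) * z j a)
              ≈⟨ ΣF-cong (λ j → solve 3 (λ θ θk x → ((θ :- θk) :* x) := (θ :* x :+ (:- θk) :* x)) refl (t j) (t k) (z j a)) ⟩
            ΣF (λ j → t j * z j a + - t k * z j a)   ≈⟨ ΣF-distrib-+ (λ j → t j * z j a) (λ j → - t k * z j a) ⟩
            T + ΣF (λ j → - t k * z j a)             ≈⟨ +-congˡ (*-distribˡ-ΣF (- t k) (λ j → z j a)) ⟨
            T + - t k * S                            ≈⟨ +-congˡ (sym (-‿distribˡ-* (t k) S)) ⟩
            T - t k * S                              ∎

        u′ : Fin N → Vec N
        u′ = updateAt z k (λ _ → w)

        u′-k : u′ k ≡ w
        u′-k = updateAt-updates k z

        u′-off : ∀ j → j ≢ k → u′ j ≡ z j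
        u′-off j j≢k = updateAt-minimal j k z j≢k

        u′-eigen : IsEigenFamily u′
        u′-eigen j with j ≟ k
        ... | yes ≡.refl = ≡.subst (λ v → (M · v) ≈V (t k • v)) (≡.sym u′-k) w-eigen
        ... | no j≢k     = ≡.subst (λ v → (M · v) ≈V (t j • v)) (≡.sym (u′-off j j≢k))
                                   (•-eigenvector (ι j) (component-eigen D j))

        decomposition : EigenDecomposition (q k)
        decomposition = record
          { component       = u′
          ; component-eigen = u′-eigen
          ; root-scale      = ι root * root-scale D
          ; root-component  = λ a → begin
              u′ root a                          ≡⟨ ≡.cong-app (u′-off root (k≢root ∘ ≡.sym)) a ⟩
              ι root * u root a                  ≈⟨ *-congˡ (root-component D a) ⟩
              ι root * (root-scale D * q root a) ≈⟨ *-assoc _ _ _ ⟨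
              ι root * root-scale D * q root a   ∎
          ; sums-to         = λ a → begin
              q k a              ≈⟨ solve 2 (λ q s → q := (s :+ (q :- s))) refl (q k a) (ΣV z a) ⟩
              ΣV z a + w a       ≡⟨ ≡.cong-app (≡.cong (λ v b → ΣV z b + v b) u′-k) a ⟨
              ΣV z a + u′ k a    ≈⟨ ΣF-replace (λ j → u′ j a) (λ j → z j a) k
                                      (λ j j≢k → reflexive (≡.cong-app (u′-off j j≢k) a)) ⟨
              ΣV u′ a + z k a    ≈⟨ +-congˡ (z-k≈0 a) ⟩
              ΣV u′ a + 0#       ≈⟨ +-identityʳ _ ⟩
              ΣV u′ a            ∎
          }

        vanishes : VanishesAbove (rank k) decomposition
        vanishes j k<j a = begin
          u′ j a        ≡⟨ ≡.cong-app (u′-off j j≢k) a ⟩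
          ι j * u j a   ≈⟨ *-congˡ (D-vanishes j (ℕP.<-trans r<k k<j) a) ⟩
          ι j * 0#      ≈⟨ zeroʳ (ι j) ⟩
          0#            ∎
          where
          j≢k : j ≢ k
          j≢k ≡.refl = ℕP.<-irrefl ≡.refl k<j

      -- The bound b on the rank makes the recursion structural.
      decompose-basis-below : ∀ b k → rank k ℕ.< b → Σ (EigenDecomposition (q k)) (VanishesAbove (rank k))
      decompose-basis-below (suc b) k k<1+b with k ≟ root
      ... | yes ≡.refl = root-decomposition
      ... | no k≢root with q-step k k≢root
      ...   | k′ , k′<k , s , Mqk with decompose-basis-below b k′ (ℕP.<-≤-trans k′<k (ℕ.s≤s⁻¹ k<1+b))
      ...     | D , D-vanishes = Extension.decomposition k≢root k′<k D′ D′-vanishes Mqk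
                               , Extension.vanishes k≢root k′<k D′ D′-vanishes Mqk
        where
        D′ : EigenDecomposition (s • q k′)
        D′ = decomposition-• s D
        D′-vanishes : VanishesAbove (rank k′) D′
        D′-vanishes = decomposition-•-vanishes s D D-vanishes

      decompose : ∀ v → EigenDecomposition v
      decompose v with q-spans v
      ... | x , v≈Σxq = decomposition-cong (sym ∘ v≈Σxq) (decomposition-ΣV (λ k →
            decomposition-• (x k) (proj₁ (decompose-basis-below (suc (rank k)) k (ℕP.n<1+n (rank k))))))

      module Projections (E : Fin N → Mat N) (E-primitive : ∀ i → IsPrimitiveIdempotent M (t i) (E i)) where

        E-component : ∀ {v} (D : EigenDecomposition v) i → (E i · v) ≈V component D i
        E-component D i a = trans (·-cong (E i) (sums-to D) a) (E-picks-component E E-primitive (component-eigen D) i a)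

        E-resolution : ∀ v → ΣV (λ j → E j · v) ≈V v
        E-resolution v a = trans (ΣF-cong (λ j → E-component D j a)) (sym (sums-to D a))
          where
          D : EigenDecomposition v
          D = decompose v

        M-resolution : ∀ v → (M · v) ≈V ΣV (λ j → t j • (E j · v))
        M-resolution v a = begin
          (M · v) a                          ≈⟨ ·-cong M (sums-to D) a ⟩
          (M · ΣV (component D)) a           ≈⟨ ·-ΣV M (component D) a ⟩
          ΣF (λ j → (M · component D j) a)   ≈⟨ ΣF-cong (λ j → component-eigen D j a) ⟩
          ΣF (λ j → t j * component D j a)   ≈⟨ ΣF-cong (λ j → *-congˡ (E-component D j a)) ⟨
          ΣF (λ j → t j * (E j · v) a)       ∎
          where
          D : EigenDecomposition v
          D = decompose v

        E-commutes : ∀ v i → (E i · (M · v)) ≈V (t i • (E i · v))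
        E-commutes v i a = begin
          (E i · (M · v)) a        ≈⟨ ·-cong (E i) (λ b → trans (·-cong M (sums-to D) b) (·-ΣV M (component D) b)) a ⟩
          (E i · ΣV (λ j → M · component D j)) a ≈⟨ ·-cong (E i) (λ b → ΣF-cong (λ j → component-eigen D j b)) a ⟩
          (E i · ΣV (λ j → t j • component D j)) a ≈⟨ E-picks-component E E-primitive (λ j → •-eigenvector (t j) (component-eigen D j)) i a ⟩
          t i * component D i a    ≈⟨ *-congˡ (E-component D i a) ⟨
          t i * (E i · v) a        ∎
          where
          D : EigenDecomposition v
          D = decompose v

        E-root-image : ∀ v → ∃ λ β → (E root · v) ≈V (β • q root)
        E-root-image v = root-scale D , λ a → trans (E-component D root a) (root-component D a)
          where
          D : EigenDecomposition v
          D = decompose v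

  module Proposition8p4
    (n : ℕ)
    (A : Mat (suc (suc (suc n)))) (E : Fin (suc (suc (suc n))) → Mat (suc (suc (suc n))))
    (A* : Mat (suc (suc (suc n)))) (E* : Fin (suc (suc (suc n))) → Mat (suc (suc (suc n))))
    (θ θ* : Fin (suc (suc (suc n))) → Carrier)
    (Φ : PreLeonardSystem (suc (suc n)) A E A* E* θ θ*) (φ : Fin (suc (suc n)) → Carrier)
    (P Q : Mat (suc (suc (suc n)))) (PQ≈I : (P ⊙ Q) ≈M I)
    (A-rep : Represents P (lowerBidiag θ) A) (A*-rep : Represents P (upperBidiag θ* φ) A*)
    where
    open PreLeonardSystem Φ

    d N : ℕ
    d = suc (suc n)
    N = suc d

    p : Fin N → Vec N
    p = col P

    last penult : Fin N
    last   = fromℕ d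
    penult = inject₁ (fromℕ (suc n))

    A-last : (A · p last) ≈V (θ last • p last)
    A-last a = trans (A-rep a last) (lowerBidiag-last-column θ (λ m → P a m))

    A-step : ∀ k → (A · p (inject₁ k)) ≈V (λ a → θ (inject₁ k) * p (inject₁ k) a + p (suc k) a)
    A-step k a = trans (A-rep a (inject₁ k)) (lowerBidiag-column θ (λ m → P a m) k)

    A*-first : (A* · p zero) ≈V (θ* zero • p zero)
    A*-first a = trans (A*-rep a zero) (upperBidiag-first-column θ* φ (λ m → P a m))

    A*-step : ∀ k → (A* · p (suc k)) ≈V (λ a → θ* (suc k) * p (suc k) a + φ k * p (inject₁ k) a)
    A*-step k a = trans (A*-rep a (suc k)) (upperBidiag-column θ* φ (λ m → P a m) k)

    A-rank : Fin N → ℕ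
    A-rank k = d ∸ toℕ k

    A-q-step : ∀ k → k ≢ last → ∃ λ k′ → A-rank k′ ℕ.< A-rank k × ∃ λ s →
                 (A · p k) ≈V (λ a → θ k * p k a + s * p k′ a)
    A-q-step k k≢last with ≢fromℕ⇒inject₁ k k≢last
    ... | k′ , ≡.refl = suc k′ , rank-drop , 1# , λ a → trans (A-step k′ a) (+-congˡ (sym (*-identityˡ _)))
      where
      rank-drop : A-rank (suc k′) ℕ.< A-rank (inject₁ k′)
      rank-drop rewrite toℕ-inject₁ k′ = ℕP.∸-monoʳ-< (ℕP.n<1+n (toℕ k′)) (toℕ<n k′)

    A*-q-step : ∀ k → k ≢ zero → ∃ λ k′ → toℕ k′ ℕ.< toℕ k × ∃ λ s →
                  (A* · p k) ≈V (λ a → θ* k * p k a + s * p k′ a)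
    A*-q-step zero    0≢0 = ⊥-elim (0≢0 ≡.refl)
    A*-q-step (suc k) _   = inject₁ k , ℕ.s≤s (ℕP.≤-reflexive (toℕ-inject₁ k)) , φ k , A*-step k

    p-spans : ∀ v → ∃ λ (x : Fin N → Carrier) → v ≈V ΣV (λ k → x k • p k)
    p-spans v = Q · v , columns-span {P = P} {Q} PQ≈I v

    module A-spectrum = Diagonalisation.TriangularBasis A θ E-distinct p last A-rank A-last A-q-step p-spans
    module A*-spectrum = Diagonalisation.TriangularBasis A* θ* E*-distinct p zero toℕ A*-first A*-q-step p-spans
    open A-spectrum.Projections E E-prim
    open A*-spectrum.Projections E* E*-prim using () renaming (E-root-image to E*-root-image)

    module AtRow (a : Fin N) where

      ε : Vec N → Carrier
      ε v = (E last · v) a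

      κ : Vec N → Carrier
      κ v = ε (A* · v)

      ε-cong : ∀ {v w} → v ≈V w → ε v ≈ ε w
      ε-cong v≈w = ·-cong (E last) v≈w a

      ε-+ : ∀ v w → ε (λ b → v b + w b) ≈ ε v + ε w
      ε-+ v w = ·-+ (E last) v w a

      ε-• : ∀ s v → ε (s • v) ≈ s * ε v
      ε-• s v = ·-• (E last) s v a

      κ-cong : ∀ {v w} → v ≈V w → κ v ≈ κ w
      κ-cong v≈w = ε-cong (·-cong A* v≈w)

      κ-• : ∀ s v → κ (s • v) ≈ s * κ v
      κ-• s v = trans (ε-cong (·-• A* s v)) (ε-• s (A* · v))

      κ-ΣV : ∀ (u : Fin N → Vec N) → κ (ΣV u) ≈ ΣF (λ j → κ (u j))
      κ-ΣV u = trans (ε-cong (·-ΣV A* u)) (·-ΣV (E last) (λ j → A* · u j) a)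

      ε-two-terms : ∀ s v r w → ε (λ b → s * v b + r * w b) ≈ s * ε v + r * ε w
      ε-two-terms s v r w = trans (ε-+ (s • v) (r • w)) (+-cong (ε-• s v) (ε-• r w))

      e₀ e₁ π γ : Carrier
      e₀ = ε (p zero)
      e₁ = ε (p (suc zero))
      π  = P a last
      γ  = proj₁ (E-root-image (p zero))

      e₀≈γπ : e₀ ≈ γ * π
      e₀≈γπ = proj₂ (E-root-image (p zero)) a

      ε-A-step : ∀ k → θ last * ε (p (inject₁ k)) ≈ θ (inject₁ k) * ε (p (inject₁ k)) + ε (p (suc k))
      ε-A-step k = begin
        θ last * ε (p (inject₁ k))   ≈⟨ E-commutes (p (inject₁ k)) last a ⟨
        ε (A · p (inject₁ k))        ≈⟨ ε-cong (A-step k) ⟩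
        ε (λ b → (θ (inject₁ k) • p (inject₁ k)) b + p (suc k) b) ≈⟨ ε-+ (θ (inject₁ k) • p (inject₁ k)) (p (suc k)) ⟩
        ε (θ (inject₁ k) • p (inject₁ k)) + ε (p (suc k)) ≈⟨ +-cong (ε-• (θ (inject₁ k)) (p (inject₁ k))) refl ⟩
        θ (inject₁ k) * ε (p (inject₁ k)) + ε (p (suc k)) ∎

      ε-p-last : ε (p last) ≈ π
      ε-p-last = proj₁ (proj₂ (E-prim last)) (p last) A-last a

      e₁≈ : e₁ ≈ (θ last - θ zero) * e₀
      e₁≈ = sym (x*e≈y*e+f⇒[x-y]*e≈f (ε-A-step zero))

      penult-gap : (θ last - θ penult) * ε (p penult) ≈ π
      penult-gap = x*e≈y*e+f⇒[x-y]*e≈f (trans (ε-A-step (fromℕ (suc n))) (+-congˡ ε-p-last))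

      κ-p₀ : κ (p zero) ≈ θ* zero * e₀
      κ-p₀ = trans (ε-cong A*-first) (ε-• (θ* zero) (p zero))

      κ-p₁ : κ (p (suc zero)) ≈ θ* (suc zero) * e₁ + φ zero * e₀
      κ-p₁ = trans (ε-cong (A*-step zero)) (ε-two-terms (θ* (suc zero)) (p (suc zero)) (φ zero) (p zero))

      κ-p-last : κ (p last) ≈ θ* last * π + φ (fromℕ (suc n)) * ε (p penult)
      κ-p-last = trans (ε-cong (A*-step (fromℕ (suc n))))
                       (trans (ε-two-terms (θ* last) (p last) (φ (fromℕ (suc n))) (p penult)) (+-cong (*-congˡ ε-p-last) refl))

      weight : Fin N → Carrier
      weight j = θ j - θ penult

      term : Fin N → Carrier
      term j = weight j * κ (E j · p zero)

      Σ-term : ΣF term ≈ (θ zero - θ penult) * κ (p zero) + κ (p (suc zero))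
      Σ-term = begin
        ΣF term
          ≈⟨ ΣF-cong (λ j → solve 3 (λ x y z → ((x :- y) :* z) := (x :* z :+ (:- y) :* z))
                                    refl (θ j) (θ penult) (κ (E j · p zero))) ⟩
        ΣF (λ j → θ j * κ (E j · p zero) + - θ penult * κ (E j · p zero))
          ≈⟨ ΣF-distrib-+ (λ j → θ j * κ (E j · p zero)) (λ j → - θ penult * κ (E j · p zero)) ⟩
        ΣF (λ j → θ j * κ (E j · p zero)) + ΣF (λ j → - θ penult * κ (E j · p zero))
          ≈⟨ +-cong Σθκ (sym (*-distribˡ-ΣF (- θ penult) (λ j → κ (E j · p zero)))) ⟩
        κ (A · p zero) + - θ penult * ΣF (λ j → κ (E j · p zero))
          ≈⟨ +-cong κAp₀ (*-congˡ Σκ) ⟩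
        (θ zero * κ (p zero) + κ (p (suc zero))) + - θ penult * κ (p zero)
          ≈⟨ solve 4 (λ x y u v → ((x :* u :+ v) :+ (:- y) :* u) := ((x :- y) :* u :+ v))
                     refl (θ zero) (θ penult) (κ (p zero)) (κ (p (suc zero))) ⟩
        (θ zero - θ penult) * κ (p zero) + κ (p (suc zero))
          ∎
        where
        Σθκ : ΣF (λ j → θ j * κ (E j · p zero)) ≈ κ (A · p zero)
        Σθκ = begin
          ΣF (λ j → θ j * κ (E j · p zero))        ≈⟨ ΣF-cong (λ j → κ-• (θ j) (E j · p zero)) ⟨
          ΣF (λ j → κ (θ j • (E j · p zero)))      ≈⟨ κ-ΣV (λ j → θ j • (E j · p zero)) ⟨
          κ (ΣV (λ j → θ j • (E j · p zero)))      ≈⟨ κ-cong (M-resolution (p zero)) ⟨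
          κ (A · p zero)                           ∎
        Σκ : ΣF (λ j → κ (E j · p zero)) ≈ κ (p zero)
        Σκ = trans (sym (κ-ΣV (λ j → E j · p zero))) (κ-cong (E-resolution (p zero)))
        κAp₀ : κ (A · p zero) ≈ θ zero * κ (p zero) + κ (p (suc zero))
        κAp₀ = trans (κ-cong (A-step zero))
                 (trans (ε-cong (·-+ A* (θ zero • p zero) (p (suc zero))))
                   (trans (ε-+ (A* · (θ zero • p zero)) (A* · p (suc zero))) (+-cong (κ-• (θ zero) (p zero)) refl)))

      term-last : term last ≈ ((θ last - θ penult) * θ* last + φ (fromℕ (suc n))) * e₀
      term-last = begin
        wL * κ (E last · p zero)            ≈⟨ *-congˡ (κ-cong (proj₂ (E-root-image (p zero)))) ⟩
        wL * κ (γ • p last)                 ≈⟨ *-congˡ (trans (κ-• γ (p last)) (*-congˡ κ-p-last)) ⟩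
        wL * (γ * (θ* last * π + φL * ε (p penult)))
          ≈⟨ solve 6 (λ c γ t π f e → (c :* (γ :* (t :* π :+ f :* e))) := ((c :* t :* (γ :* π)) :+ γ :* f :* (c :* e))) refl wL γ (θ* last) π φL (ε (p penult)) ⟩
        wL * θ* last * (γ * π) + γ * φL * (wL * ε (p penult)) ≈⟨ +-congˡ (*-congˡ penult-gap) ⟩
        wL * θ* last * (γ * π) + γ * φL * π
          ≈⟨ solve 5 (λ c γ t π f → ((c :* t :* (γ :* π)) :+ γ :* f :* π) := ((c :* t :+ f) :* (γ :* π))) refl wL γ (θ* last) π φL ⟩
        (wL * θ* last + φL) * (γ * π)       ≈⟨ *-congˡ e₀≈γπ ⟨
        (wL * θ* last + φL) * e₀            ∎
        where
        wL φL : Carrier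
        wL = θ last - θ penult
        φL = φ (fromℕ (suc n))

      ϑ-gap : Carrier
      ϑ-gap = vartheta θ θ* φ zero - vartheta θ θ* φ (fromℕ (suc n))

      -- Split off j = d − 1, whose weight is zero, and j = d.
      Σ-term-below-penult : ΣF (λ (i : Fin (suc n)) → term (inject₁ (inject₁ i))) ≈ ϑ-gap * e₀
      Σ-term-below-penult = begin
        S
          ≈⟨ solve 4 (λ S y X L → S := (((S :+ (y :- y) :* X) :+ L) :- L)) refl S (θ penult) (κ (E penult · p zero)) (term last) ⟩
        ((S + term penult) + term last) - term last             ≈⟨ +-cong (sym split) (-‿cong term-last) ⟩
        ΣF term - ((θ last - θ penult) * θ* last + φL) * e₀
          ≈⟨ +-congʳ (trans Σ-term (+-cong (*-congˡ κ-p₀) (trans κ-p₁ (+-congʳ (*-congˡ e₁≈))))) ⟩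
        ((θ zero - θ penult) * (θ* zero * e₀) + (θ* (suc zero) * ((θ last - θ zero) * e₀) + φ zero * e₀))
          - ((θ last - θ penult) * θ* last + φL) * e₀
          ≈⟨ solve 9 (λ t₀ tp s₀ e s₁ tL f₀ sL fL →
               (((t₀ :- tp) :* (s₀ :* e) :+ (s₁ :* ((tL :- t₀) :* e) :+ f₀ :* e)) :- ((tL :- tp) :* sL :+ fL) :* e)
               := (((f₀ :- (s₁ :- s₀) :* (t₀ :- tL)) :- (fL :- (sL :- s₀) :* (tp :- tL))) :* e))
             refl (θ zero) (θ penult) (θ* zero) e₀ (θ* (suc zero)) (θ last) (φ zero) (θ* last) φL ⟩
        ϑ-gap * e₀                                              ∎
        where
        S φL : Carrier
        S = ΣF (λ (i : Fin (suc n)) → term (inject₁ (inject₁ i)))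
        φL = φ (fromℕ (suc n))
        split : ΣF term ≈ (S + term penult) + term last
        split = trans (ΣF-init-last term) (+-congʳ (ΣF-init-last (term ∘ inject₁)))

    ι : Fin (suc n) → Fin N
    ι i = inject₁ (inject₁ i)

    weighted-product : Fin (suc n) → Mat N
    weighted-product i = (θ (ι i) - θ penult) ⋆ (E last ⊙ (A* ⊙ (E (ι i) ⊙ E* zero)))

    conclusion : ΣM weighted-product ≈M ((vartheta θ θ* φ zero - vartheta θ θ* φ (fromℕ (suc n))) ⋆ (E last ⊙ E* zero))
    conclusion a b = begin
      ΣM weighted-product a b                         ≡⟨ ΣM-entry weighted-product a b ⟩
      ΣF (λ i → weight (ι i) * κ (E (ι i) · y))      ≈⟨ ΣF-cong term-at-y ⟩
      ΣF (λ i → β* * term (ι i))                      ≈⟨ *-distribˡ-ΣF β* (λ i → term (ι i)) ⟨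
      β* * ΣF (λ i → term (ι i))                      ≈⟨ *-congˡ Σ-term-below-penult ⟩
      β* * (ϑ-gap * e₀)                               ≈⟨ solve 3 (λ b g e → (b :* (g :* e)) := (g :* (b :* e))) refl β* ϑ-gap e₀ ⟩
      ϑ-gap * (β* * e₀)                               ≈⟨ *-congˡ (trans (ε-cong y≈β*p₀) (ε-• β* (p zero))) ⟨
      ϑ-gap * ε y                                     ∎
      where
      open AtRow a
      y : Vec N
      y = col (E* zero) b
      β* : Carrier
      β* = proj₁ (E*-root-image (col I b))
      y≈β*p₀ : y ≈V (β* • p zero)
      y≈β*p₀ m = trans (sym (·-col-I (E* zero) b m)) (proj₂ (E*-root-image (col I b)) m)
      term-at-y : ∀ i → weight (ι i) * κ (E (ι i) · y) ≈ β* * term (ι i)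
      term-at-y i = begin
        weight (ι i) * κ (E (ι i) · y)                  ≈⟨ *-congˡ (κ-cong (λ m → trans (·-cong (E (ι i)) y≈β*p₀ m) (·-• (E (ι i)) β* (p zero) m))) ⟩
        weight (ι i) * κ (β* • (E (ι i) · p zero))      ≈⟨ *-congˡ (κ-• β* (E (ι i) · p zero)) ⟩
        weight (ι i) * (β* * κ (E (ι i) · p zero))
          ≈⟨ solve 3 (λ w b k → (w :* (b :* k)) := (b :* (w :* k))) refl (weight (ι i)) β* (κ (E (ι i) · p zero)) ⟩
        β* * term (ι i)                                 ∎


proposition8p4 : ∀ {c ℓ} (F : Field c ℓ) → let open FieldDefs F in
    -- d = n + 2 (so d ≥ 2); V = F^(d+1)
    (n : ℕ) →
    (A : Mat (suc (suc (suc n)))) (E : Fin (suc (suc (suc n))) → Mat (suc (suc (suc n))))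
    (A* : Mat (suc (suc (suc n)))) (E* : Fin (suc (suc (suc n))) → Mat (suc (suc (suc n))))
    (θ θ* : Fin (suc (suc (suc n))) → Carrier) →
    PreLeonardSystem (suc (suc n)) A E A* E* θ θ* →
    (φ : Fin (suc (suc n)) → Carrier) →
    (∃ λ P → Invertible P
             × Represents P (lowerBidiag θ) A
             × Represents P (upperBidiag θ* φ) A*) →
    ΣM (λ (i : Fin (suc n)) →
          (θ (inject₁ (inject₁ i)) -F θ (inject₁ (fromℕ (suc n))))
            ⋆ (E (fromℕ (suc (suc n))) ⊙ (A* ⊙ (E (inject₁ (inject₁ i)) ⊙ E* zero))))
    ≈M ((vartheta θ θ* φ zero -F vartheta θ θ* φ (fromℕ (suc n)))
          ⋆ (E (fromℕ (suc (suc n))) ⊙ E* zero))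
proposition8p4 F n A E A* E* θ θ* Φ φ (P , (Q , PQ≈I , _) , A-rep , A*-rep) =
  Proposition8p4.conclusion F n A E A* E* θ θ* Φ φ P Q PQ≈I A-rep A*-rep
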